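{- $\mathbf{QBDi3}=\mathbf{QDN3}+\neg\neg(A\lor{\sim}A)$; that is, for every set of formulas $\Gamma$ and formula $A$ of $\mathcal{L}_Q$, $A$ is derivable from $\Gamma$ in $\mathbf{QBDi3}$ if and only if $A$ is derivable from $\Gamma$ in the system obtained from $\mathbf{QDN3}$ by adding the axiom schema $\neg\neg(B\lor{\sim}B)$.
   Context: $\mathcal{L}_Q$: first-order language with $\bot,{\sim},\land,\lor,\to,\forall,\exists$, constants, variables, predicate symbols; $\neg A:=A\to\bot$, $A\leftrightarrow B:=(A\to B)\land(B\to A)$. Derivability in a Hilbert system: a finite list ending in the conclusion, each item a premise, an axiom instance, or obtained from earlier items by MP (from $A$, $A\to B$ infer $B$) or Gen (from $A$ infer $\forall xA$). Common axioms (C): $A\to(B\to A)$; $(A\to(B\to C))\to((A\to B)\to(A\to C))$; $(A\land B)\to A$; $(A\land B)\to B$; $(C\to A)\to((C\to B)\to(C\to(A\land B)))$; $A\to(A\lor B)$; $B\to(A\lor B)$; $(A\to C)\to((B\to C)\to((A\lor B)\to C))$; $\bot\to A$; $A(t)\to\exists xA$; $\forall x(A(x)\to B)\to(\exists xA(x)\to B)$ ($x$ not free in $B$); $\forall x(B\to A)\to(B\to\forall xA)$ ($x$ not free in $B$); $\forall xA\to A(t)$; $A\to{\sim}\bot$; ${\sim}{\sim}A\leftrightarrow A$; ${\sim}(A\land B)\leftrightarrow({\sim}A\lor{\sim}B)$; ${\sim}(A\lor B)\leftrightarrow({\sim}A\land{\sim}B)$; ${\sim}\forall xA\leftrightarrow\exists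 x{\sim}A$; ${\sim}\exists xA\leftrightarrow\forall x{\sim}A$. $\mathbf{QBDi3}$: (C) plus ${\sim}(A\to B)\leftrightarrow(\neg{\sim}A\land{\sim}B)$, $\forall x\neg\neg A\to\neg\neg\forall xA$, ${\sim}A\to\neg A$, $\neg\neg(A\lor{\sim}A)$, with MP and Gen. $\mathbf{QDN3}$: (C) plus ${\sim}(A\to B)\leftrightarrow(\neg\neg A\land{\sim}B)$ and ${\sim}A\to\neg A$, with MP and Gen. -}

module Defs where

open import Data.Nat using (ℕ; _≡ᵇ_)
open import Data.Bool using (Bool; true; false; _∧_; _∨_; not; if_then_else_; T)
open import Data.List using (List; []; _∷_; map)
open import Data.Product using (_×_)
open import Level using (0ℓ)
open import Relation.Unary using (Pred)

data Term : Set where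
  var   : ℕ → Term
  const : ℕ → Term

data Formula : Set where
  atom : ℕ → List Term → Formula
  ⊥'   : Formula
  ∼_   : Formula → Formula
  _∧'_ : Formula → Formula → Formula
  _∨'_ : Formula → Formula → Formula
  _⇒_  : Formula → Formula → Formula
  ∀'   : ℕ → Formula → Formula
  ∃'   : ℕ → Formula → Formula

infix  9 ∼_
infixl 7 _∧'_
infixl 6 _∨'_
infixr 5 _⇒_
infix  4 _⇔'_

¬' : Formula → Formula
¬' A = A ⇒ ⊥'

_⇔'_ : Formula → Formula → Formula
A ⇔' B = (A ⇒ B) ∧' (B ⇒ A)

occursT : ℕ → Term → Bool
occursT x (var y)   = x ≡ᵇ y
occursT x (const _) = false

occursTs : ℕ → List Term → Bool
occursTs x []       = false
occursTs x (t ∷ ts) = occursT x t ∨ occursTs x ts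

freeIn : ℕ → Formula → Bool
freeIn x (atom _ ts) = occursTs x ts
freeIn x ⊥'          = false
freeIn x (∼ A)       = freeIn x A
freeIn x (A ∧' B)    = freeIn x A ∨ freeIn x B
freeIn x (A ∨' B)    = freeIn x A ∨ freeIn x B
freeIn x (A ⇒ B)     = freeIn x A ∨ freeIn x B
freeIn x (∀' y A)    = not (x ≡ᵇ y) ∧ freeIn x A
freeIn x (∃' y A)    = not (x ≡ᵇ y) ∧ freeIn x A

substT : Term → ℕ → Term → Term
substT (var y)   x t = if x ≡ᵇ y then t else var y
substT (const c) x t = const c

subst : Formula → ℕ → Term → Formula
subst (atom P ts) x t = atom P (map (λ s → substT s x t) ts)
subst ⊥'          x t = ⊥'
subst (∼ A)       x t = ∼ subst A x t
subst (A ∧' B)    x t = subst A x t ∧' subst B x t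
subst (A ∨' B)    x t = subst A x t ∨' subst B x t
subst (A ⇒ B)     x t = subst A x t ⇒ subst B x t
subst (∀' y A)    x t = if x ≡ᵇ y then ∀' y A else ∀' y (subst A x t)
subst (∃' y A)    x t = if x ≡ᵇ y then ∃' y A else ∃' y (subst A x t)

freeFor : Term → ℕ → Formula → Bool
freeFor t x (atom _ _) = true
freeFor t x ⊥'         = true
freeFor t x (∼ A)      = freeFor t x A
freeFor t x (A ∧' B)   = freeFor t x A ∧ freeFor t x B
freeFor t x (A ∨' B)   = freeFor t x A ∧ freeFor t x B
freeFor t x (A ⇒ B)    = freeFor t x A ∧ freeFor t x B
freeFor t x (∀' y A)   =
  (x ≡ᵇ y) ∨ (not (freeIn x A) ∨ (not (occursT y t) ∧ freeFor t x A))
freeFor t x (∃' y A)   =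
  (x ≡ᵇ y) ∨ (not (freeIn x A) ∨ (not (occursT y t) ∧ freeFor t x A))

data Common : Formula → Set where
  K    : ∀ A B → Common (A ⇒ (B ⇒ A))
  S    : ∀ A B C → Common ((A ⇒ (B ⇒ C)) ⇒ ((A ⇒ B) ⇒ (A ⇒ C)))
  ∧E₁  : ∀ A B → Common ((A ∧' B) ⇒ A)
  ∧E₂  : ∀ A B → Common ((A ∧' B) ⇒ B)
  ∧I   : ∀ A B C → Common ((C ⇒ A) ⇒ ((C ⇒ B) ⇒ (C ⇒ (A ∧' B))))
  ∨I₁  : ∀ A B → Common (A ⇒ (A ∨' B))
  ∨I₂  : ∀ A B → Common (B ⇒ (A ∨' B))
  ∨E   : ∀ A B C → Common ((A ⇒ C) ⇒ ((B ⇒ C) ⇒ ((A ∨' B) ⇒ C)))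
  efq  : ∀ A → Common (⊥' ⇒ A)
  ∃I   : ∀ x A t → T (freeFor t x A) → Common (subst A x t ⇒ ∃' x A)
  ∃E   : ∀ x A B → T (not (freeIn x B)) →
         Common (∀' x (A ⇒ B) ⇒ (∃' x A ⇒ B))
  ∀I   : ∀ x A B → T (not (freeIn x B)) →
         Common (∀' x (B ⇒ A) ⇒ (B ⇒ ∀' x A))
  ∀E   : ∀ x A t → T (freeFor t x A) → Common (∀' x A ⇒ subst A x t)
  ∼⊥   : ∀ A → Common (A ⇒ ∼ ⊥')
  ∼∼   : ∀ A → Common (∼ ∼ A ⇔' A)
  ∼∧   : ∀ A B → Common (∼ (A ∧' B) ⇔' (∼ A ∨' ∼ B))
  ∼∨   : ∀ A B → Common (∼ (A ∨' B) ⇔' (∼ A ∧' ∼ B))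
  ∼∀   : ∀ x A → Common (∼ ∀' x A ⇔' ∃' x (∼ A))
  ∼∃   : ∀ x A → Common (∼ ∃' x A ⇔' ∀' x (∼ A))

data QBDi3Ax : Formula → Set where
  common : ∀ {A} → Common A → QBDi3Ax A
  ∼⇒     : ∀ A B → QBDi3Ax (∼ (A ⇒ B) ⇔' (¬' (∼ A) ∧' ∼ B))
  dnsh   : ∀ x A → QBDi3Ax (∀' x (¬' (¬' A)) ⇒ ¬' (¬' (∀' x A)))
  ∼¬     : ∀ A → QBDi3Ax (∼ A ⇒ ¬' A)
  ¬¬lem  : ∀ A → QBDi3Ax (¬' (¬' (A ∨' ∼ A)))

data QDN3Ax : Formula → Set where
  common : ∀ {A} → Common A → QDN3Ax A
  ∼⇒     : ∀ A B → QDN3Ax (∼ (A ⇒ B) ⇔' (¬' (¬' A) ∧' ∼ B))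
  ∼¬     : ∀ A → QDN3Ax (∼ A ⇒ ¬' A)

data QDN3+Ax : Formula → Set where
  qdn3   : ∀ {A} → QDN3Ax A → QDN3+Ax A
  ¬¬lem  : ∀ B → QDN3+Ax (¬' (¬' (B ∨' ∼ B)))

-- Hilbert-style derivability from a set of premises Γ, with MP and
-- (unrestricted) Gen. Derivation trees correspond exactly to the finite
-- lists of the paper.

data _⊢[_]_ (Γ : Pred Formula 0ℓ) (Ax : Pred Formula 0ℓ) : Formula → Set where
  prem : ∀ {A} → Γ A → Γ ⊢[ Ax ] A
  ax   : ∀ {A} → Ax A → Γ ⊢[ Ax ] A
  mp   : ∀ {A B} → Γ ⊢[ Ax ] A → Γ ⊢[ Ax ] (A ⇒ B) → Γ ⊢[ Ax ] B
  gen  : ∀ {A} x → Γ ⊢[ Ax ] A → Γ ⊢[ Ax ] ∀' x A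

infix 3 _⊢[_]_

-- Both systems share (C), ∼A → ¬A and ¬¬(A ∨ ∼A), so each axiom of one is derived in the
-- other.  Given ∼A → ¬A, the formula ¬¬A implies ¬∼A; given ¬¬(A ∨ ∼A), ¬∼A implies ¬¬A.
-- Hence ¬¬A ⇔ ¬∼A, which converts the two falsity conditions for ∼(A → B) into each other.
-- The double-negation shift ∀x¬¬A → ¬¬∀xA follows from ¬¬(∀xA ∨ ∼∀xA): the case ∼∀xA
-- gives ∃x∼A, and a witness ∼A, hence ¬A, refutes the instance ¬¬A of ∀x¬¬A.
module Submission where

open import Defs
open import Level using (0ℓ)
open import Relation.Unary using (Pred; _⊆_)
open import Data.Product using (_×_; _,_)
open import Data.Nat using (zero; suc; _≡ᵇ_)
open import Data.Nat.Properties using (≡ᵇ⇒≡; ≡⇒≡ᵇ)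
open import Data.Bool using (true; false; not; T)
open import Data.Bool.Properties using (T-≡; T-∧; T-∨)
open import Data.List using (List; []; _∷_)
open import Data.List.Properties using (map-cong; map-id)
open import Data.Sum using (inj₂)
open import Function using (_∘_)
open import Function.Bundles using (Equivalence)
open import Relation.Binary.PropositionalEquality
  using (_≡_; refl; trans; cong; cong₂) renaming (subst to transport)

open Equivalence using (to; from)

≡ᵇ-refl : ∀ x → (x ≡ᵇ x) ≡ true
≡ᵇ-refl x = to T-≡ (≡⇒≡ᵇ x x refl)

≡ᵇ-sym : ∀ x y → (x ≡ᵇ y) ≡ (y ≡ᵇ x)
≡ᵇ-sym zero    zero    = refl
≡ᵇ-sym zero    (suc y) = refl
≡ᵇ-sym (suc x) zero    = refl
≡ᵇ-sym (suc x) (suc y) = ≡ᵇ-sym x y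

substT-self : ∀ s x → substT s x (var x) ≡ s
substT-self (var y)   x with x ≡ᵇ y in x≡ᵇy
... | true  = cong var (≡ᵇ⇒≡ x y (from T-≡ x≡ᵇy))
... | false = refl
substT-self (const c) x = refl

subst-self : ∀ A x → subst A x (var x) ≡ A
subst-self (atom P ts) x =
  cong (atom P) (trans (map-cong (λ s → substT-self s x) ts) (map-id ts))
subst-self ⊥'       x = refl
subst-self (∼ A)    x = cong ∼_ (subst-self A x)
subst-self (A ∧' B) x = cong₂ _∧'_ (subst-self A x) (subst-self B x)
subst-self (A ∨' B) x = cong₂ _∨'_ (subst-self A x) (subst-self B x)
subst-self (A ⇒ B)  x = cong₂ _⇒_ (subst-self A x) (subst-self B x)
subst-self (∀' y A) x with x ≡ᵇ y
... | true  = refl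
... | false = cong (∀' y) (subst-self A x)
subst-self (∃' y A) x with x ≡ᵇ y
... | true  = refl
... | false = cong (∃' y) (subst-self A x)

freeFor-self : ∀ A x → T (freeFor (var x) x A)
freeFor-self (atom _ _) x = _
freeFor-self ⊥'         x = _
freeFor-self (∼ A)      x = freeFor-self A x
freeFor-self (A ∧' B)   x = from T-∧ (freeFor-self A x , freeFor-self B x)
freeFor-self (A ∨' B)   x = from T-∧ (freeFor-self A x , freeFor-self B x)
freeFor-self (A ⇒ B)    x = from T-∧ (freeFor-self A x , freeFor-self B x)
freeFor-self (∀' y A)   x rewrite ≡ᵇ-sym y x with x ≡ᵇ y
... | true  = _
... | false = from (T-∨ {not (freeIn x A)}) (inj₂ (freeFor-self A x))
freeFor-self (∃' y A)   x rewrite ≡ᵇ-sym y x with x ≡ᵇ y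
... | true  = _
... | false = from (T-∨ {not (freeIn x A)}) (inj₂ (freeFor-self A x))

derive-axioms : ∀ {Γ Ax₁ Ax₂} → Ax₁ ⊆ (Γ ⊢[ Ax₂ ]_) → (Γ ⊢[ Ax₁ ]_) ⊆ (Γ ⊢[ Ax₂ ]_)
derive-axioms axiom (prem p)  = prem p
derive-axioms axiom (ax a)    = axiom a
derive-axioms axiom (mp p q)  = mp (derive-axioms axiom p) (derive-axioms axiom q)
derive-axioms axiom (gen x p) = gen x (derive-axioms axiom p)

module Hilbert {Ax : Pred Formula 0ℓ} (common : Common ⊆ Ax) {Γ : Pred Formula 0ℓ} where

  infix 2 ⊢_ _⊩_
  infixr 4 _⟶_
  infixl 5 _·_

  ⊢_ : Formula → Set
  ⊢ A = Γ ⊢[ Ax ] A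

  private variable
    A B C D P Q X Y : Formula
    Δ : List Formula

  k : ⊢ A ⇒ B ⇒ A
  k = ax (common (K _ _))

  s : ⊢ (A ⇒ B ⇒ C) ⇒ (A ⇒ B) ⇒ A ⇒ C
  s = ax (common (S _ _ _))

  I : ⊢ A ⇒ A
  I {A} = mp (k {A} {A}) (mp (k {A} {A ⇒ A}) s)

  _∘⇒_ : ⊢ B ⇒ C → ⊢ A ⇒ B → ⊢ A ⇒ C
  g ∘⇒ f = mp f (mp (mp g k) s)

  -- The head of the list is the innermost antecedent, so it is the most recent hypothesis.
  _⟶_ : List Formula → Formula → Formula
  []      ⟶ A = A
  (D ∷ Δ) ⟶ A = Δ ⟶ D ⇒ A

  close : ∀ Δ → ⊢ A → ⊢ Δ ⟶ A
  close []      p = p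
  close (D ∷ Δ) p = close Δ (mp p k)

  lift : ∀ Δ → ⊢ A ⇒ B → ⊢ (Δ ⟶ A) ⇒ (Δ ⟶ B)
  lift []      f = f
  lift (D ∷ Δ) f = lift Δ (mp (mp f k) s)

  lift₂ : ∀ Δ → ⊢ A ⇒ B ⇒ C → ⊢ (Δ ⟶ A) ⇒ (Δ ⟶ B) ⇒ (Δ ⟶ C)
  lift₂ []      f = f
  lift₂ (D ∷ Δ) f = lift₂ Δ (s ∘⇒ mp (mp f k) s)

  record _⊩_ (Δ : List Formula) (A : Formula) : Set where
    constructor ⟪_⟫
    field derivation : ⊢ Δ ⟶ A
  open _⊩_

  given : ⊢ A → [] ⊩ A
  given = ⟪_⟫

  prove : [] ⊩ A → ⊢ A
  prove = derivation

  discharge : (A ∷ Δ) ⊩ B → Δ ⊩ A ⇒ B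
  discharge ⟪ p ⟫ = ⟪ p ⟫

  closed : ⊢ A → Δ ⊩ A
  closed {Δ = Δ} p = ⟪ close Δ p ⟫

  map⊩ : ⊢ A ⇒ B → Δ ⊩ A → Δ ⊩ B
  map⊩ {Δ = Δ} f ⟪ p ⟫ = ⟪ mp p (lift Δ f) ⟫

  map₂⊩ : ⊢ A ⇒ B ⇒ C → Δ ⊩ A → Δ ⊩ B → Δ ⊩ C
  map₂⊩ {Δ = Δ} f ⟪ p ⟫ ⟪ q ⟫ = ⟪ mp q (mp p (lift₂ Δ f)) ⟫

  _·_ : Δ ⊩ A ⇒ B → Δ ⊩ A → Δ ⊩ B
  _·_ = map₂⊩ I

  weaken : Δ ⊩ A → (D ∷ Δ) ⊩ A
  weaken p = ⟪ derivation (map⊩ k p) ⟫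

  var₀ : (A ∷ Δ) ⊩ A
  var₀ {Δ = Δ} = ⟪ close Δ I ⟫

  var₁ : (B ∷ A ∷ Δ) ⊩ A
  var₁ = weaken var₀

  var₂ : (C ∷ B ∷ A ∷ Δ) ⊩ A
  var₂ = weaken var₁

  ∧-intro : Δ ⊩ A → Δ ⊩ B → Δ ⊩ A ∧' B
  ∧-intro {A = A} {B = B} p q =
    map₂⊩ (ax (common (∧I A B (⊥' ⇒ ⊥')))) (map⊩ k p) (map⊩ k q) · closed I

  ∧-elim₁ : Δ ⊩ A ∧' B → Δ ⊩ A
  ∧-elim₁ = map⊩ (ax (common (∧E₁ _ _)))

  ∧-elim₂ : Δ ⊩ A ∧' B → Δ ⊩ B
  ∧-elim₂ = map⊩ (ax (common (∧E₂ _ _)))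

  ∨-cases : Δ ⊩ A ⇒ C → Δ ⊩ B ⇒ C → Δ ⊩ A ∨' B ⇒ C
  ∨-cases = map₂⊩ (ax (common (∨E _ _ _)))

  ⇔-sym : ⊢ P ⇔' Q → ⊢ Q ⇔' P
  ⇔-sym e = prove (∧-intro (∧-elim₂ (given e)) (∧-elim₁ (given e)))

  ⇔-trans : ⊢ P ⇔' Q → ⊢ Q ⇔' X → ⊢ P ⇔' X
  ⇔-trans e e′ = prove (∧-intro
    (discharge (weaken (∧-elim₁ (given e′)) · (weaken (∧-elim₁ (given e)) · var₀)))
    (discharge (weaken (∧-elim₂ (given e)) · (weaken (∧-elim₂ (given e′)) · var₀))))

  ∧-congʳ : ⊢ X ⇔' Y → ⊢ (X ∧' Q) ⇔' (Y ∧' Q)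
  ∧-congʳ e = prove (∧-intro (discharge (along (∧-elim₁ (given e))))
                             (discharge (along (∧-elim₂ (given e)))))
    where
    along : ∀ {X Y Q} → [] ⊩ X ⇒ Y → (X ∧' Q ∷ []) ⊩ Y ∧' Q
    along f = ∧-intro (weaken f · ∧-elim₁ var₀) (∧-elim₂ var₀)

  ∀-elim-self : ∀ x A → ⊢ ∀' x A ⇒ A
  ∀-elim-self x A =
    transport (λ B → ⊢ ∀' x A ⇒ B) (subst-self A x)
      (ax (common (∀E x A (var x) (freeFor-self A x))))

  ∃-elim : ∀ x → T (not (freeIn x B)) → ⊢ A ⇒ B → ⊢ ∃' x A ⇒ B
  ∃-elim x x∉B f = mp (gen x f) (ax (common (∃E x _ _ x∉B)))

  module _ (∼⇒¬ : ∀ A → ⊢ ∼ A ⇒ ¬' A) (¬¬-lem : ∀ A → ⊢ ¬' (¬' (A ∨' ∼ A))) where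

    ¬¬⇔¬∼ : ∀ A → ⊢ ¬' (¬' A) ⇔' ¬' (∼ A)
    ¬¬⇔¬∼ A = prove (∧-intro
      (discharge (discharge (var₁ · (closed (∼⇒¬ A) · var₀))))
      (discharge (discharge (closed (¬¬-lem A) · ∨-cases var₀ var₁))))

    ¬¬-shift : ∀ x A → ⊢ ∀' x (¬' (¬' A)) ⇒ ¬' (¬' (∀' x A))
    ¬¬-shift x A = prove (discharge (discharge
      (closed (¬¬-lem (∀' x A)) · ∨-cases var₀ (discharge (counterexample · var₂)))))
      where
      refute : ⊢ ∼ A ⇒ ¬' (∀' x (¬' (¬' A)))
      refute = prove (discharge (discharge
        (closed (∀-elim-self x (¬' (¬' A))) · var₀ · (closed (∼⇒¬ A) · var₁))))

      x∉ : T (not (freeIn x (¬' (∀' x (¬' (¬' A))))))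
      x∉ rewrite ≡ᵇ-refl x = _

      counterexample : (∼ ∀' x A ∷ Δ) ⊩ ¬' (∀' x (¬' (¬' A)))
      counterexample =
        closed (∃-elim x x∉ refute ∘⇒ prove (∧-elim₁ (given (ax (common (∼∀ x A)))))) · var₀

QBDi3⊆QDN3+ : ∀ {Γ} → QBDi3Ax ⊆ (Γ ⊢[ QDN3+Ax ]_)
QBDi3⊆QDN3+ {Γ} = derive
  where
  open Hilbert {QDN3+Ax} (qdn3 ∘ common) {Γ}

  derive : QBDi3Ax ⊆ (Γ ⊢[ QDN3+Ax ]_)
  derive (common c)  = ax (qdn3 (common c))
  derive (∼⇒ A B)    =
    ⇔-trans (ax (qdn3 (∼⇒ A B))) (∧-congʳ (¬¬⇔¬∼ (ax ∘ qdn3 ∘ ∼¬) (ax ∘ ¬¬lem) A))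
  derive (dnsh x A)  = ¬¬-shift (ax ∘ qdn3 ∘ ∼¬) (ax ∘ ¬¬lem) x A
  derive (∼¬ A)      = ax (qdn3 (∼¬ A))
  derive (¬¬lem A)   = ax (¬¬lem A)

QDN3+⊆QBDi3 : ∀ {Γ} → QDN3+Ax ⊆ (Γ ⊢[ QBDi3Ax ]_)
QDN3+⊆QBDi3 {Γ} = derive
  where
  open Hilbert {QBDi3Ax} common {Γ}

  derive : QDN3+Ax ⊆ (Γ ⊢[ QBDi3Ax ]_)
  derive (qdn3 (common c)) = ax (common c)
  derive (qdn3 (∼⇒ A B))   =
    ⇔-trans (ax (∼⇒ A B)) (∧-congʳ (⇔-sym (¬¬⇔¬∼ (ax ∘ ∼¬) (ax ∘ ¬¬lem) A)))
  derive (qdn3 (∼¬ A))     = ax (∼¬ A)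
  derive (¬¬lem A)         = ax (¬¬lem A)

proposition4p7 : (Γ : Pred Formula 0ℓ) (A : Formula) →
    ((Γ ⊢[ QBDi3Ax ] A) → (Γ ⊢[ QDN3+Ax ] A)) ×
    ((Γ ⊢[ QDN3+Ax ] A) → (Γ ⊢[ QBDi3Ax ] A))
proposition4p7 Γ A = derive-axioms QBDi3⊆QDN3+ , derive-axioms QDN3+⊆QBDi3
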